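{- Let $N\ge1$ be an odd integer, $p$ an odd prime with $p\nmid N$, and $\Delta$ a discriminant with $p\mid\Delta$. For an integer $M\ge1$ let $R_M(\Delta)=\{\varrho\in\mathbb Z/2M\mathbb Z:\ \varrho^2\equiv\Delta \pmod{4M}\}$ and, for $\varrho\in R_M(\Delta)$, $m_\varrho=\gcd\big(M,\varrho,\frac{\varrho^2-\Delta}{4M}\big)$ (computed with any integer representative of $\varrho$; this is independent of the choice). If $R_N(\Delta)$ is non-empty, then the natural reduction map $\mathbb Z/2Np\mathbb Z\to\mathbb Z/2N\mathbb Z$ induces a bijection $r_d:R_{Np}(\Delta)\to R_N(\Delta)$, and: (i) if $p^2\nmid\Delta$, then $m_{\varrho'}=m_{r_d(\varrho')}$ for all $\varrho'\in R_{Np}(\Delta)$; (ii) if $p^2\mid\Delta$, then $m_{\varrho'}=p\,m_{r_d(\varrho')}$ for all $\varrho'\in R_{Np}(\Delta)$.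
   Context: A discriminant is an integer congruent to $0$ or $1$ modulo $4$. -}

module Defs where

open import Data.Nat as ℕ using (ℕ; zero; suc; _<_)
import Data.Nat.DivMod as ℕD
open import Data.Integer as ℤ using (ℤ; +_; _-_)
open import Data.Integer.Divisibility using (_∣_)
open import Data.Integer.GCD using (gcd)
open import Data.Product using (_×_)
open import Data.Sum using (_⊎_)

IsDiscriminant : ℤ → Set
IsDiscriminant Δ = (+ 4 ∣ Δ) ⊎ (+ 4 ∣ Δ - + 1)

-- Total exact-division helper: a / b for b ≠ 0 (value at b = 0 is an
-- irrelevant convention, never used since all moduli here are ≥ 1).
quot : ℤ → ℕ → ℤ
quot a zero    = ℤ.0ℤ
quot a (suc k) = a ℤ./ + suc k

modℕ : ℕ → ℕ → ℕ
modℕ a zero    = a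
modℕ a (suc k) = a ℕD.% suc k

-- ϱ ∈ R_M(Δ), with ℤ/2Mℤ represented by the representatives 0 ≤ ϱ < 2M.
InR : ℕ → ℤ → ℕ → Set
InR M Δ ϱ = (ϱ < 2 ℕ.* M) × (+ (4 ℕ.* M) ∣ (+ ϱ ℤ.* + ϱ) - Δ)

mρ : ℕ → ℤ → ℕ → ℤ
mρ M Δ ϱ = gcd (gcd (+ M) (+ ϱ)) (quot ((+ ϱ ℤ.* + ϱ) - Δ) (4 ℕ.* M))

reduce : ℕ → ℕ → ℕ
reduce N ϱ = modℕ ϱ (2 ℕ.* N)

{-# OPTIONS --safe #-}
module Submission where

-- Every ϱ′ ∈ R_{Np}(Δ) is divisible by p (since p ∣ Δ) and is uniquely ρ + 2Nk with ρ = r_d(ϱ′)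
-- and 0 ≤ k < p. As p ∤ 2N, each ρ ∈ R_N(Δ) has exactly one k < p with p ∣ ρ + 2Nk, and that lift
-- lies in R_{Np}(Δ) because 4N and p are coprime: this is the bijection. Expanding (ρ + 2Nk)² shows
-- that Q = (ρ² − Δ)/4N and Q′ = (ϱ′² − Δ)/4Np satisfy pQ′ = Q + ρk + Nk², hence
-- m_ρ = gcd(N, ϱ′, pQ′), while m_ϱ′ = gcd(Np, ϱ′, Q′); moreover p² ∣ Δ iff p ∣ Q′. If p ∤ Q′, every
-- common divisor of either triple is prime to p and the two gcds coincide; if p ∣ Q′, then p factors
-- out of gcd(Np, ϱ′, Q′) and what remains is gcd(N, ϱ′, pQ′) because p ∤ N.

open import Defs
open import Data.Nat as ℕ using (ℕ; suc; _<_; _≤_; NonZero)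
open import Data.Nat.Divisibility as ℕDiv using (divides)
open import Data.Nat.DivMod as ℕ using (_%_; _/_)
import Data.Nat.Properties as ℕ
open import Data.Nat.GCD as ℕ using (module Bézout)
open import Data.Nat.Coprimality as Coprimality using (Coprime)
open import Data.Nat.Primality using (Prime; euclidsLemma; prime⇒irreducible; prime⇒nonZero; prime[2]; ¬prime[1])
open import Data.Integer as ℤ using (ℤ; +_; ∣_∣; _-_)
import Data.Integer.Properties as ℤ
open import Data.Integer.Divisibility using (_∣_)
open import Data.Integer.Divisibility.Signed as ℤDiv using () renaming (_∣_ to _∣ₛ_)
open import Data.Integer.GCD using (gcd; gcd[i,j]∣i; gcd[i,j]∣j; gcd-greatest)
import Data.Integer.DivMod as ℤ
import Data.Integer.Tactic.RingSolver as ℤRing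
import Data.Nat.Tactic.RingSolver as ℕRing
open import Data.Product using (_×_; _,_; ∃-syntax; proj₁; proj₂)
open import Data.Sum using (inj₁; inj₂; [_,_]′)
open import Function using (id; _⇔_; mk⇔; Equivalence)
open import Relation.Nullary using (¬_; contradiction)
open import Relation.Binary.PropositionalEquality

module _ where
  open import Data.Nat using (_+_; _*_; _∸_)

  prime∤⇒coprime : ∀ {p m} → Prime p → ¬ (p ℕDiv.∣ m) → Coprime p m
  prime∤⇒coprime p-prime p∤m (d∣p , d∣m) with prime⇒irreducible p-prime d∣p
  ... | inj₁ d≡1  = d≡1
  ... | inj₂ refl = contradiction d∣m p∤m

  odd-prime∤2 : ∀ {p} → Prime p → ¬ (2 ℕDiv.∣ p) → ¬ (p ℕDiv.∣ 2)
  odd-prime∤2 p-prime 2∤p p∣2 with prime⇒irreducible prime[2] p∣2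
  ... | inj₁ refl = ¬prime[1] p-prime
  ... | inj₂ refl = 2∤p ℕDiv.∣-refl

  odd-prime∤4* : ∀ {p m} → Prime p → ¬ (2 ℕDiv.∣ p) → ¬ (p ℕDiv.∣ m) → ¬ (p ℕDiv.∣ 4 * m)
  odd-prime∤4* {p} {m} p-prime 2∤p p∤m p∣4m with euclidsLemma 4 m p-prime p∣4m
  ... | inj₁ p∣4 = [ p∤2 , p∤2 ]′ (euclidsLemma 2 2 p-prime p∣4)
    where
    p∤2 : ¬ (p ℕDiv.∣ 2)
    p∤2 = odd-prime∤2 p-prime 2∤p
  ... | inj₂ p∣m = p∤m p∣m

  ∣∧<⇒≡0 : ∀ {m x} .{{_ : NonZero m}} → m ℕDiv.∣ x → x < m → x ≡ 0
  ∣∧<⇒≡0 {m} {x} m∣x x<m = trans (sym (ℕ.m<n⇒m%n≡m x<m)) (ℕDiv.n∣m⇒m%n≡0 x m m∣x)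

  coprime⇒*∣ : ∀ {m n o} → Coprime m n → m ℕDiv.∣ o → n ℕDiv.∣ o → m * n ℕDiv.∣ o
  coprime⇒*∣ {m} {n} c (divides q refl) n∣qm
    with Coprimality.coprime-divisor (Coprimality.sym c) (subst (n ℕDiv.∣_) (ℕ.*-comm q m) n∣qm)
  ... | divides r refl = divides r (trans (ℕ.*-assoc r n m) (cong (r *_) (ℕ.*-comm n m)))

  coprime⇒inverse : ∀ {p m} .{{_ : NonZero p}} → Coprime p m → ∃[ u ] p ℕDiv.∣ 1 + u * m
  coprime⇒inverse p⊥m with Coprimality.coprime-Bézout p⊥m
  ... | Bézout.+- x y eq = y , divides x eq
  coprime⇒inverse {suc p₁} {m} p⊥m | Bézout.-+ x y eq = y * p₁ , divides (1 + p₁ * x) (begin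
    1 + y * p₁ * m            ≡⟨ regroup y p₁ m ⟩
    1 + p₁ * (y * m)          ≡⟨ cong (λ z → 1 + p₁ * z) eq ⟨
    1 + p₁ * (1 + x * suc p₁) ≡⟨ expand p₁ x ⟩
    (1 + p₁ * x) * suc p₁     ∎)
    where
    open ≡-Reasoning
    regroup : ∀ y p₁ m → 1 + y * p₁ * m ≡ 1 + p₁ * (y * m)
    regroup = ℕRing.solve-∀
    expand : ∀ p₁ x → 1 + p₁ * (1 + x * suc p₁) ≡ (1 + p₁ * x) * suc p₁
    expand = ℕRing.solve-∀

  module _ {p m : ℕ} .{{_ : NonZero p}} (p⊥m : Coprime p m) where

    lift-≤ : ∀ {r a b} → a ≤ b → b < p → p ℕDiv.∣ r + a * m → p ℕDiv.∣ r + b * m → b ≤ a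
    lift-≤ {r} {a} {b} a≤b b<p p∣a p∣b = ℕ.m∸n≡0⇒m≤n (∣∧<⇒≡0 p∣b∸a (ℕ.≤-<-trans (ℕ.m∸n≤m b a) b<p))
      where
      shift : ∀ r a d m → r + (a + d) * m ≡ (r + a * m) + m * d
      shift = ℕRing.solve-∀
      split : r + b * m ≡ (r + a * m) + m * (b ∸ a)
      split = trans (cong (λ x → r + x * m) (sym (ℕ.m+[n∸m]≡n a≤b))) (shift r a (b ∸ a) m)
      p∣b∸a : p ℕDiv.∣ b ∸ a
      p∣b∸a = Coprimality.coprime-divisor p⊥m (ℕDiv.∣m+n∣m⇒∣n (subst (p ℕDiv.∣_) split p∣b) p∣a)

    lift-unique : ∀ {r i j} → i < p → j < p → p ℕDiv.∣ r + i * m → p ℕDiv.∣ r + j * m → i ≡ j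
    lift-unique {i = i} {j} i<p j<p p∣i p∣j with ℕ.≤-total i j
    ... | inj₁ i≤j = ℕ.≤-antisym i≤j (lift-≤ i≤j j<p p∣i p∣j)
    ... | inj₂ j≤i = ℕ.≤-antisym (lift-≤ j≤i i<p p∣j p∣i) j≤i

    lift-exists : ∀ r → ∃[ k ] k < p × p ℕDiv.∣ r + k * m
    lift-exists r with coprime⇒inverse p⊥m
    ... | u , p∣1+um = k % p , ℕ.m%n<n k p
      , ℕDiv.∣m+n∣m⇒∣n (subst (p ℕDiv.∣_) split (ℕDiv.∣n⇒∣m*n r p∣1+um)) (ℕDiv.n∣m*n (k / p * m))
      where
      k : ℕ
      k = r * u
      distrib : ∀ r u m → r * (1 + u * m) ≡ r + r * u * m
      distrib = ℕRing.solve-∀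
      regroup : ∀ r m a b p → r + (a + b * p) * m ≡ b * m * p + (r + a * m)
      regroup = ℕRing.solve-∀
      split : r * (1 + u * m) ≡ k / p * m * p + (r + k % p * m)
      split = begin
        r * (1 + u * m)           ≡⟨ distrib r u m ⟩
        r + k * m                 ≡⟨ cong (λ z → r + z * m) (ℕ.m≡m%n+[m/n]*n k p) ⟩
        r + (k % p + k / p * p) * m ≡⟨ regroup r m (k % p) (k / p) p ⟩
        k / p * m * p + (r + k % p * m) ∎
        where open ≡-Reasoning

module _ where
  open import Data.Integer using (_+_; _*_)

  coprime-divisorℤ : ∀ {d k x} → Coprime ∣ d ∣ k → d ∣ₛ + k * x → d ∣ₛ x
  coprime-divisorℤ {d} {k} {x} d⊥k d∣kx = ℤDiv.∣ᵤ⇒∣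
    (Coprimality.coprime-divisor d⊥k (subst (∣ d ∣ ℕDiv.∣_) (ℤ.abs-* (+ k) x) (ℤDiv.∣⇒∣ᵤ d∣kx)))

  ∣∧prime∤⇒coprime : ∀ {p d x} → Prime p → ¬ (+ p ∣ₛ x) → d ∣ₛ x → Coprime ∣ d ∣ p
  ∣∧prime∤⇒coprime p-prime p∤x d∣x (e∣d , e∣p) with prime⇒irreducible p-prime e∣p
  ... | inj₁ e≡1  = e≡1
  ... | inj₂ refl = contradiction (ℤDiv.∣-trans (ℤDiv.∣ᵤ⇒∣ e∣d) d∣x) p∤x

  quot-exact : ∀ a q m .{{_ : NonZero m}} → a ≡ q * + m → quot a m ≡ q
  quot-exact a q (suc k) a≡qm = ℤ.*-cancelʳ-≡ s q m (trans (sym a≡sm) a≡qm)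
    where
    open ≡-Reasoning
    m s : ℤ
    m = + suc k
    s = a ℤ./ m
    r : ℕ
    r = a ℤ.% m
    a≡r+sm : a ≡ + r + s * m
    a≡r+sm = ℤ.a≡a%n+[a/n]*n a m
    cancel : ∀ r s m → r ≡ (r + s * m) - s * m
    cancel = ℤRing.solve-∀
    factor : ∀ q s m → q * m - s * m ≡ (q - s) * m
    factor = ℤRing.solve-∀
    r≡[q-s]m : + r ≡ (q - s) * m
    r≡[q-s]m = begin
      + r                ≡⟨ cancel (+ r) s m ⟩
      (+ r + s * m) - s * m ≡⟨ cong (_- s * m) (trans (sym a≡r+sm) a≡qm) ⟩
      q * m - s * m      ≡⟨ factor q s m ⟩
      (q - s) * m        ∎
    r≡0 : r ≡ 0
    r≡0 = ∣∧<⇒≡0 (ℤDiv.∣⇒∣ᵤ (ℤDiv.divides (q - s) r≡[q-s]m)) (ℤ.n%d<d a m)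
    a≡sm : a ≡ s * m
    a≡sm = trans a≡r+sm (trans (cong (λ x → + x + s * m) r≡0) (ℤ.+-identityˡ (s * m)))

  prime²∣⇔∣quotient : ∀ {p k x Δ Q} → Prime p → ¬ (p ℕDiv.∣ k) → + p ∣ₛ x
                    → x * x - Δ ≡ Q * (+ k * + p) → (+ (p ℕ.* p) ∣ₛ Δ) ⇔ (+ p ∣ₛ Q)
  prime²∣⇔∣quotient {p} {k} {_} {Δ} {Q} p-prime p∤k (ℤDiv.divides a refl) eq = mk⇔ to from
    where
    P K : ℤ
    P = + p
    K = + k
    instance
      _ : NonZero p
      _ = prime⇒nonZero p-prime
    Δ≡Py : Δ ≡ P * (a * a * P - Q * K)
    Δ≡Py = begin
      Δ                                 ≡⟨ complement (a * P) Δ ⟩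
      a * P * (a * P) - (a * P * (a * P) - Δ) ≡⟨ cong (a * P * (a * P) -_) eq ⟩
      a * P * (a * P) - Q * (K * P)     ≡⟨ factor a P Q K ⟩
      P * (a * a * P - Q * K)           ∎
      where
      open ≡-Reasoning
      complement : ∀ x Δ → Δ ≡ x * x - (x * x - Δ)
      complement = ℤRing.solve-∀
      factor : ∀ a P Q K → a * P * (a * P) - Q * (K * P) ≡ P * (a * a * P - Q * K)
      factor = ℤRing.solve-∀
    P∣aaP : P ∣ₛ a * a * P
    P∣aaP = ℤDiv.∣n⇒∣m*n (a * a) ℤDiv.∣-refl
    P⊥k : Coprime ∣ P ∣ k
    P⊥k = prime∤⇒coprime p-prime p∤k
    to : + (p ℕ.* p) ∣ₛ Δ → P ∣ₛ Q
    to p²∣Δ = coprime-divisorℤ P⊥k (subst (P ∣ₛ_) (ℤ.*-comm Q K) P∣QK)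
      where
      P∣y : P ∣ₛ a * a * P - Q * K
      P∣y = ℤDiv.*-cancelˡ-∣ P (subst₂ _∣ₛ_ (ℤ.pos-* p p) Δ≡Py p²∣Δ)
      complement : ∀ u v → v ≡ u - (u - v)
      complement = ℤRing.solve-∀
      P∣QK : P ∣ₛ Q * K
      P∣QK = subst (P ∣ₛ_) (sym (complement (a * a * P) (Q * K))) (ℤDiv.∣m∣n⇒∣m-n P∣aaP P∣y)
    from : P ∣ₛ Q → + (p ℕ.* p) ∣ₛ Δ
    from P∣Q = subst₂ _∣ₛ_ (sym (ℤ.pos-* p p)) (sym Δ≡Py)
      (ℤDiv.*-monoʳ-∣ P (ℤDiv.∣m∣n⇒∣m-n P∣aaP (ℤDiv.∣m⇒∣m*n K P∣Q)))

  gcd₃ : ℤ → ℤ → ℤ → ℤ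
  gcd₃ a b c = gcd (gcd a b) c

  CommonDivisor : ℤ → ℤ → ℤ → ℤ → Set
  CommonDivisor d a b c = d ∣ₛ a × d ∣ₛ b × d ∣ₛ c

  gcd₃-commonDivisor : ∀ a b c → CommonDivisor (gcd₃ a b c) a b c
  gcd₃-commonDivisor a b c =
      ℤDiv.∣ᵤ⇒∣ (ℕDiv.∣-trans (gcd[i,j]∣i (gcd a b) c) (gcd[i,j]∣i a b))
    , ℤDiv.∣ᵤ⇒∣ (ℕDiv.∣-trans (gcd[i,j]∣i (gcd a b) c) (gcd[i,j]∣j a b))
    , ℤDiv.∣ᵤ⇒∣ (gcd[i,j]∣j (gcd a b) c)

  gcd₃-greatest : ∀ {d a b c} → CommonDivisor d a b c → d ∣ₛ gcd₃ a b c
  gcd₃-greatest {d} {a} {b} {c} (d∣a , d∣b , d∣c) = ℤDiv.∣ᵤ⇒∣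
    (gcd-greatest {gcd a b} {c} {d} (gcd-greatest {a} {b} {d} (ℤDiv.∣⇒∣ᵤ d∣a) (ℤDiv.∣⇒∣ᵤ d∣b)) (ℤDiv.∣⇒∣ᵤ d∣c))

  commonDivisor⇔⇒gcd₃≡ : ∀ {a b c a′ b′ c′} → (∀ {d} → CommonDivisor d a b c ⇔ CommonDivisor d a′ b′ c′)
                       → gcd₃ a b c ≡ gcd₃ a′ b′ c′
  commonDivisor⇔⇒gcd₃≡ {a} {b} {c} {a′} {b′} {c′} same = cong +_ (ℕDiv.∣-antisym
    (ℤDiv.∣⇒∣ᵤ (gcd₃-greatest (Equivalence.to same (gcd₃-commonDivisor a b c))))
    (ℤDiv.∣⇒∣ᵤ (gcd₃-greatest (Equivalence.from same (gcd₃-commonDivisor a′ b′ c′)))))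

  gcd₃-*ˡ : ∀ k a b c → gcd₃ (+ k * a) (+ k * b) (+ k * c) ≡ + k * gcd₃ a b c
  gcd₃-*ˡ k a b c rewrite ℤ.abs-* (+ k) a | ℤ.abs-* (+ k) b | ℤ.abs-* (+ k) c = begin
    + ℕ.gcd (ℕ.gcd (k ℕ.* ∣ a ∣) (k ℕ.* ∣ b ∣)) (k ℕ.* ∣ c ∣)
      ≡⟨ cong (λ g → + ℕ.gcd g (k ℕ.* ∣ c ∣)) (ℕ.c*gcd[m,n]≡gcd[cm,cn] k ∣ a ∣ ∣ b ∣) ⟨
    + ℕ.gcd (k ℕ.* ℕ.gcd ∣ a ∣ ∣ b ∣) (k ℕ.* ∣ c ∣)
      ≡⟨ cong +_ (ℕ.c*gcd[m,n]≡gcd[cm,cn] k (ℕ.gcd ∣ a ∣ ∣ b ∣) ∣ c ∣) ⟨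
    + (k ℕ.* ℕ.gcd (ℕ.gcd ∣ a ∣ ∣ b ∣) ∣ c ∣)
      ≡⟨ ℤ.pos-* k _ ⟩
    + k * gcd₃ a b c ∎
    where open ≡-Reasoning

  gcd₃-shift : ∀ n r q l a b → gcd₃ n r q ≡ gcd₃ n (r + n * l) (q + r * a + n * b)
  gcd₃-shift n r q l a b = commonDivisor⇔⇒gcd₃≡ (mk⇔ to from)
    where
    to : ∀ {d} → CommonDivisor d n r q → CommonDivisor d n (r + n * l) (q + r * a + n * b)
    to (d∣n , d∣r , d∣q) = d∣n
      , ℤDiv.∣m∣n⇒∣m+n d∣r (ℤDiv.∣m⇒∣m*n l d∣n)
      , ℤDiv.∣m∣n⇒∣m+n (ℤDiv.∣m∣n⇒∣m+n d∣q (ℤDiv.∣m⇒∣m*n a d∣r)) (ℤDiv.∣m⇒∣m*n b d∣n)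
    from : ∀ {d} → CommonDivisor d n (r + n * l) (q + r * a + n * b) → CommonDivisor d n r q
    from {d} (d∣n , d∣r′ , d∣q′) = d∣n , d∣r
      , ℤDiv.∣m+n∣n⇒∣m (ℤDiv.∣m+n∣n⇒∣m d∣q′ (ℤDiv.∣m⇒∣m*n b d∣n)) (ℤDiv.∣m⇒∣m*n a d∣r)
      where
      d∣r : d ∣ₛ r
      d∣r = ℤDiv.∣m+n∣n⇒∣m d∣r′ (ℤDiv.∣m⇒∣m*n l d∣n)

  module _ {p : ℕ} (p-prime : Prime p) {n : ℤ} (p∤n : ¬ (+ p ∣ₛ n)) where

    gcd₃-transfer-prime : ∀ {b c} → ¬ (+ p ∣ₛ c) → gcd₃ (n * + p) b c ≡ gcd₃ n b (+ p * c)
    gcd₃-transfer-prime {b} {c} p∤c = commonDivisor⇔⇒gcd₃≡ (mk⇔ to from)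
      where
      to : ∀ {d} → CommonDivisor d (n * + p) b c → CommonDivisor d n b (+ p * c)
      to (d∣np , d∣b , d∣c) =
          coprime-divisorℤ (∣∧prime∤⇒coprime p-prime p∤c d∣c) (subst (_ ∣ₛ_) (ℤ.*-comm n (+ p)) d∣np)
        , d∣b , ℤDiv.∣n⇒∣m*n (+ p) d∣c
      from : ∀ {d} → CommonDivisor d n b (+ p * c) → CommonDivisor d (n * + p) b c
      from (d∣n , d∣b , d∣pc) =
        ℤDiv.∣m⇒∣m*n (+ p) d∣n , d∣b , coprime-divisorℤ (∣∧prime∤⇒coprime p-prime p∤n d∣n) d∣pc

    gcd₃-factor-prime : ∀ {b c} → + p ∣ₛ b → + p ∣ₛ c → gcd₃ (n * + p) b c ≡ + p * gcd₃ n b (+ p * c)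
    gcd₃-factor-prime (ℤDiv.divides b refl) (ℤDiv.divides c refl) = begin
      gcd₃ (n * P) (b * P) (c * P)      ≡⟨ cong₂ (λ x y → gcd₃ x y (c * P)) (ℤ.*-comm n P) (ℤ.*-comm b P) ⟩
      gcd₃ (P * n) (P * b) (c * P)      ≡⟨ cong (gcd₃ (P * n) (P * b)) (ℤ.*-comm c P) ⟩
      gcd₃ (P * n) (P * b) (P * c)      ≡⟨ gcd₃-*ˡ p n b c ⟩
      P * gcd₃ n b c                    ≡⟨ cong (P *_) (commonDivisor⇔⇒gcd₃≡ (mk⇔ to from)) ⟩
      P * gcd₃ n (b * P) (P * (c * P))  ∎
      where
      open ≡-Reasoning
      P : ℤ
      P = + p
      to : ∀ {d} → CommonDivisor d n b c → CommonDivisor d n (b * P) (P * (c * P))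
      to (d∣n , d∣b , d∣c) = d∣n , ℤDiv.∣m⇒∣m*n P d∣b , ℤDiv.∣n⇒∣m*n P (ℤDiv.∣m⇒∣m*n P d∣c)
      from : ∀ {d} → CommonDivisor d n (b * P) (P * (c * P)) → CommonDivisor d n b c
      from {d} (d∣n , d∣bP , d∣PcP) = d∣n , cancel d∣bP , cancel (coprime-divisorℤ d⊥p d∣PcP)
        where
        d⊥p : Coprime ∣ d ∣ p
        d⊥p = ∣∧prime∤⇒coprime p-prime p∤n d∣n
        cancel : ∀ {x} → d ∣ₛ x * P → d ∣ₛ x
        cancel {x} d∣xP = coprime-divisorℤ d⊥p (subst (d ∣ₛ_) (ℤ.*-comm x P) d∣xP)

  reduce≡% : ∀ N ϱ .{{_ : NonZero (2 ℕ.* N)}} → reduce N ϱ ≡ ϱ % (2 ℕ.* N)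
  reduce≡% (suc _) ϱ = refl

  module Lifting (N p : ℕ) .{{_ : NonZero N}} (Δ : ℤ) (p-prime : Prime p)
                 (p∤4N : ¬ (p ℕDiv.∣ 4 ℕ.* N)) (p∣Δ : + p ∣ Δ) where

    instance
      _ : NonZero p
      _ = prime⇒nonZero p-prime
      _ : NonZero (2 ℕ.* N)
      _ = ℕ.m*n≢0 2 N
      _ : NonZero (4 ℕ.* N)
      _ = ℕ.m*n≢0 4 N
      _ : NonZero (4 ℕ.* (N ℕ.* p))
      _ = ℕ.m*n≢0 4 (N ℕ.* p) {{_}} {{ℕ.m*n≢0 N p}}

    n P : ℤ
    n = + N
    P = + p

    lift : ℕ → ℕ → ℕ
    lift r k = r ℕ.+ k ℕ.* (2 ℕ.* N)

    p∤2N : ¬ (p ℕDiv.∣ 2 ℕ.* N)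
    p∤2N p∣2N = p∤4N (ℕDiv.∣-trans p∣2N (divides 2 (ℕ.*-assoc 2 2 N)))

    +lift : ∀ r k → + lift r k ≡ + r + n * (+ 2 * + k)
    +lift r k = begin
      + (r ℕ.+ k ℕ.* (2 ℕ.* N))  ≡⟨ ℤ.pos-+ r (k ℕ.* (2 ℕ.* N)) ⟩
      + r + + (k ℕ.* (2 ℕ.* N))  ≡⟨ cong (λ x → + r + x) (trans (ℤ.pos-* k (2 ℕ.* N)) (cong (+ k *_) (ℤ.pos-* 2 N))) ⟩
      + r + + k * (+ 2 * n)      ≡⟨ cong (λ x → + r + x) (reorder (+ k) n) ⟩
      + r + n * (+ 2 * + k)      ∎
      where
      open ≡-Reasoning
      reorder : ∀ k n → k * (+ 2 * n) ≡ n * (+ 2 * k)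
      reorder = ℤRing.solve-∀

    lift-square : ∀ r k
                → + lift r k * + lift r k - Δ ≡ (+ r * + r - Δ) + (+ r * + k + n * (+ k * + k)) * + (4 ℕ.* N)
    lift-square r k = begin
      + lift r k * + lift r k - Δ
        ≡⟨ cong (λ x → x * x - Δ) (+lift r k) ⟩
      (+ r + n * (+ 2 * + k)) * (+ r + n * (+ 2 * + k)) - Δ
        ≡⟨ expand (+ r) (+ k) n Δ ⟩
      (+ r * + r - Δ) + (+ r * + k + n * (+ k * + k)) * (+ 4 * n)
        ≡⟨ cong (λ x → (+ r * + r - Δ) + (+ r * + k + n * (+ k * + k)) * x) (ℤ.pos-* 4 N) ⟨
      (+ r * + r - Δ) + (+ r * + k + n * (+ k * + k)) * + (4 ℕ.* N) ∎
      where
      open ≡-Reasoning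
      expand : ∀ r k n Δ
             → (r + n * (+ 2 * k)) * (r + n * (+ 2 * k)) - Δ ≡ (r * r - Δ) + (r * k + n * (k * k)) * (+ 4 * n)
      expand = ℤRing.solve-∀

    reduce-lift : ∀ {r} k → r < 2 ℕ.* N → reduce N (lift r k) ≡ r
    reduce-lift {r} k r<2N =
      trans (reduce≡% N (lift r k)) (trans (ℕ.[m+kn]%n≡m%n r k (2 ℕ.* N)) (ℕ.m<n⇒m%n≡m r<2N))

    lift-reduce : ∀ ϱ → ϱ ≡ lift (reduce N ϱ) (ϱ / (2 ℕ.* N))
    lift-reduce ϱ = trans (ℕ.m≡m%n+[m/n]*n ϱ (2 ℕ.* N))
      (cong (λ r → r ℕ.+ ϱ / (2 ℕ.* N) ℕ.* (2 ℕ.* N)) (sym (reduce≡% N ϱ)))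

    P∣Δ : P ∣ₛ Δ
    P∣Δ = ℤDiv.∣ᵤ⇒∣ p∣Δ

    p⊥2N : Coprime p (2 ℕ.* N)
    p⊥2N = prime∤⇒coprime p-prime p∤2N

    p∤n : ¬ (P ∣ₛ n)
    p∤n p∣n = p∤4N (ℕDiv.∣n⇒∣m*n 4 (ℤDiv.∣⇒∣ᵤ p∣n))

    2Np≡p*2N : 2 ℕ.* (N ℕ.* p) ≡ p ℕ.* (2 ℕ.* N)
    2Np≡p*2N = reorder N p
      where
      reorder : ∀ N p → 2 ℕ.* (N ℕ.* p) ≡ p ℕ.* (2 ℕ.* N)
      reorder = ℕRing.solve-∀

    +4Np≡4N*P : + (4 ℕ.* (N ℕ.* p)) ≡ + (4 ℕ.* N) * P
    +4Np≡4N*P = trans (cong +_ (sym (ℕ.*-assoc 4 N p))) (ℤ.pos-* (4 ℕ.* N) p)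

    lift-< : ∀ {r k} → r < 2 ℕ.* N → k < p → lift r k < 2 ℕ.* (N ℕ.* p)
    lift-< {r} {k} r<2N k<p = subst (lift r k <_) (sym 2Np≡p*2N)
      (ℕ.<-≤-trans (ℕ.+-monoˡ-< (k ℕ.* (2 ℕ.* N)) r<2N) (ℕ.*-monoˡ-≤ (2 ℕ.* N) k<p))

    /-< : ∀ {ϱ} → ϱ < 2 ℕ.* (N ℕ.* p) → ϱ / (2 ℕ.* N) < p
    /-< {ϱ} ϱ<2Np = ℕ.m<n*o⇒m/o<n (subst (ϱ <_) 2Np≡p*2N ϱ<2Np)

    ∈R[Np]⇒p∣ : ∀ {ϱ} → InR (N ℕ.* p) Δ ϱ → p ℕDiv.∣ ϱ
    ∈R[Np]⇒p∣ {ϱ} (_ , 4Np∣ϱ²-Δ) =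
      [ id , id ]′ (euclidsLemma ϱ ϱ p-prime (subst (p ℕDiv.∣_) (ℤ.abs-* (+ ϱ) (+ ϱ)) (ℤDiv.∣⇒∣ᵤ P∣ϱ²)))
      where
      P∣ϱ²-Δ : P ∣ₛ + ϱ * + ϱ - Δ
      P∣ϱ²-Δ = ℤDiv.∣-trans (ℤDiv.∣ᵤ⇒∣ {P} {+ (4 ℕ.* (N ℕ.* p))} (ℕDiv.∣n⇒∣m*n 4 (ℕDiv.n∣m*n N)))
                            (ℤDiv.∣ᵤ⇒∣ 4Np∣ϱ²-Δ)
      cancel : ∀ x Δ → (x - Δ) + Δ ≡ x
      cancel = ℤRing.solve-∀
      P∣ϱ² : P ∣ₛ + ϱ * + ϱ
      P∣ϱ² = subst (P ∣ₛ_) (cancel (+ ϱ * + ϱ) Δ) (ℤDiv.∣m∣n⇒∣m+n P∣ϱ²-Δ P∣Δ)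

    module Lift {ϱ′ : ℕ} (ϱ′∈R : InR (N ℕ.* p) Δ ϱ′) where

      ρ k : ℕ
      ρ = reduce N ϱ′
      k = ϱ′ / (2 ℕ.* N)

      4Np∣ϱ′²-Δ : + (4 ℕ.* (N ℕ.* p)) ∣ₛ + ϱ′ * + ϱ′ - Δ
      4Np∣ϱ′²-Δ = ℤDiv.∣ᵤ⇒∣ (proj₂ ϱ′∈R)

      Q′ : ℤ
      Q′ = ℤDiv.quotient 4Np∣ϱ′²-Δ

      Q′-eq : + ϱ′ * + ϱ′ - Δ ≡ Q′ * + (4 ℕ.* (N ℕ.* p))
      Q′-eq = ℤDiv._∣_.equality 4Np∣ϱ′²-Δ

      T Q : ℤ
      T = + ρ * + k + n * (+ k * + k)
      Q = P * Q′ - T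

      ϱ′≡ : + ϱ′ ≡ + ρ + n * (+ 2 * + k)
      ϱ′≡ = trans (cong +_ (lift-reduce ϱ′)) (+lift ρ k)

      ρ-eq : + ρ * + ρ - Δ ≡ Q * + (4 ℕ.* N)
      ρ-eq = begin
        + ρ * + ρ - Δ                   ≡⟨ cancel (+ ρ * + ρ - Δ) (T * M) ⟩
        (+ ρ * + ρ - Δ) + T * M - T * M ≡⟨ cong (_- T * M) (lift-square ρ k) ⟨
        + lift ρ k * + lift ρ k - Δ - T * M ≡⟨ cong (λ x → + x * + x - Δ - T * M) (lift-reduce ϱ′) ⟨
        + ϱ′ * + ϱ′ - Δ - T * M         ≡⟨ cong (_- T * M) (trans Q′-eq (cong (Q′ *_) +4Np≡4N*P)) ⟩
        Q′ * (M * P) - T * M            ≡⟨ factor Q′ M P T ⟩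
        Q * M                           ∎
        where
        open ≡-Reasoning
        M : ℤ
        M = + (4 ℕ.* N)
        cancel : ∀ x y → x ≡ x + y - y
        cancel = ℤRing.solve-∀
        factor : ∀ Q′ M P T → Q′ * (M * P) - T * M ≡ (P * Q′ - T) * M
        factor = ℤRing.solve-∀

      reduce∈R : InR N Δ ρ
      reduce∈R = subst (_< 2 ℕ.* N) (sym (reduce≡% N ϱ′)) (ℕ.m%n<n ϱ′ (2 ℕ.* N))
               , ℤDiv.∣⇒∣ᵤ (ℤDiv.divides Q ρ-eq)

      mρ-lift : mρ (N ℕ.* p) Δ ϱ′ ≡ gcd₃ (n * P) (+ ϱ′) Q′
      mρ-lift = begin
        mρ (N ℕ.* p) Δ ϱ′                                                   ≡⟨⟩
        gcd₃ (+ (N ℕ.* p)) (+ ϱ′) (quot (+ ϱ′ * + ϱ′ - Δ) (4 ℕ.* (N ℕ.* p)))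
          ≡⟨ cong₂ (λ a c → gcd₃ a (+ ϱ′) c) (ℤ.pos-* N p)
                   (quot-exact (+ ϱ′ * + ϱ′ - Δ) Q′ (4 ℕ.* (N ℕ.* p)) Q′-eq) ⟩
        gcd₃ (n * P) (+ ϱ′) Q′                                              ∎
        where open ≡-Reasoning

      mρ-reduce : mρ N Δ ρ ≡ gcd₃ n (+ ϱ′) (P * Q′)
      mρ-reduce = begin
        mρ N Δ ρ                                      ≡⟨⟩
        gcd₃ n (+ ρ) (quot (+ ρ * + ρ - Δ) (4 ℕ.* N))
          ≡⟨ cong (gcd₃ n (+ ρ)) (quot-exact (+ ρ * + ρ - Δ) Q (4 ℕ.* N) ρ-eq) ⟩
        gcd₃ n (+ ρ) Q                                ≡⟨ gcd₃-shift n (+ ρ) Q (+ 2 * + k) (+ k) (+ k * + k) ⟩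
        gcd₃ n (+ ρ + n * (+ 2 * + k)) (Q + + ρ * + k + n * (+ k * + k))
          ≡⟨ cong₂ (gcd₃ n) (sym ϱ′≡) (restore (P * Q′) (+ ρ * + k) (n * (+ k * + k))) ⟩
        gcd₃ n (+ ϱ′) (P * Q′)                        ∎
        where
        open ≡-Reasoning
        restore : ∀ x a b → x - (a + b) + a + b ≡ x
        restore = ℤRing.solve-∀

      P∣ϱ′ : P ∣ₛ + ϱ′
      P∣ϱ′ = ℤDiv.∣ᵤ⇒∣ (∈R[Np]⇒p∣ ϱ′∈R)

      p²∣Δ⇔P∣Q′ : (+ (p ℕ.* p) ∣ₛ Δ) ⇔ (P ∣ₛ Q′)
      p²∣Δ⇔P∣Q′ = prime²∣⇔∣quotient p-prime p∤4N P∣ϱ′ (trans Q′-eq (cong (Q′ *_) +4Np≡4N*P))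

    reduce-injective : ∀ {a b} → InR (N ℕ.* p) Δ a → InR (N ℕ.* p) Δ b
                     → reduce N a ≡ reduce N b → a ≡ b
    reduce-injective {a} {b} a∈R b∈R ra≡rb = begin
      a                    ≡⟨ lift-reduce a ⟩
      lift (reduce N a) ka ≡⟨ cong₂ lift ra≡rb ka≡kb ⟩
      lift (reduce N b) kb ≡⟨ lift-reduce b ⟨
      b                    ∎
      where
      open ≡-Reasoning
      ka kb : ℕ
      ka = a / (2 ℕ.* N)
      kb = b / (2 ℕ.* N)
      ka≡kb : ka ≡ kb
      ka≡kb = lift-unique p⊥2N (/-< (proj₁ a∈R)) (/-< (proj₁ b∈R))
        (subst (p ℕDiv.∣_) (lift-reduce a) (∈R[Np]⇒p∣ a∈R))
        (subst (p ℕDiv.∣_) (trans (lift-reduce b) (cong (λ r → lift r kb) (sym ra≡rb))) (∈R[Np]⇒p∣ b∈R))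

    lift-∈R : ∀ {ρ k} → InR N Δ ρ → k < p → p ℕDiv.∣ lift ρ k → InR (N ℕ.* p) Δ (lift ρ k)
    lift-∈R {ρ} {k} (ρ<2N , 4N∣ρ²-Δ) k<p p∣lift = lift-< ρ<2N k<p , 4Np∣
      where
      x : ℤ
      x = + lift ρ k * + lift ρ k - Δ
      4N∣ : + (4 ℕ.* N) ∣ₛ x
      4N∣ = subst (+ (4 ℕ.* N) ∣ₛ_) (sym (lift-square ρ k))
        (ℤDiv.∣m∣n⇒∣m+n (ℤDiv.∣ᵤ⇒∣ {+ (4 ℕ.* N)} {+ ρ * + ρ - Δ} 4N∣ρ²-Δ)
                        (ℤDiv.∣n⇒∣m*n (+ ρ * + k + n * (+ k * + k)) (ℤDiv.∣-refl {+ (4 ℕ.* N)})))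
      P∣ : P ∣ₛ x
      P∣ = ℤDiv.∣m∣n⇒∣m-n (ℤDiv.∣m⇒∣m*n (+ lift ρ k) (ℤDiv.∣ᵤ⇒∣ {P} {+ lift ρ k} p∣lift)) P∣Δ
      4Np∣ : + (4 ℕ.* (N ℕ.* p)) ∣ x
      4Np∣ = subst (ℕDiv._∣ ∣ x ∣) (ℕ.*-assoc 4 N p)
        (coprime⇒*∣ (Coprimality.sym (prime∤⇒coprime p-prime p∤4N)) (ℤDiv.∣⇒∣ᵤ 4N∣) (ℤDiv.∣⇒∣ᵤ P∣))

    reduce-surjective : ∀ {ρ} → InR N Δ ρ → ∃[ ϱ′ ] InR (N ℕ.* p) Δ ϱ′ × reduce N ϱ′ ≡ ρ
    reduce-surjective {ρ} ρ∈R =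
      let k , k<p , p∣lift = lift-exists p⊥2N ρ
      in  lift ρ k , lift-∈R ρ∈R k<p p∣lift , reduce-lift k (proj₁ ρ∈R)

    mρ-reduce-unramified : ¬ (+ (p ℕ.* p) ∣ Δ) → ∀ {ϱ′} → InR (N ℕ.* p) Δ ϱ′
                         → mρ (N ℕ.* p) Δ ϱ′ ≡ mρ N Δ (reduce N ϱ′)
    mρ-reduce-unramified p²∤Δ {ϱ′} ϱ′∈R =
      trans mρ-lift (trans (gcd₃-transfer-prime p-prime p∤n {+ ϱ′} P∤Q′) (sym mρ-reduce))
      where
      open Lift ϱ′∈R
      P∤Q′ : ¬ (P ∣ₛ Q′)
      P∤Q′ P∣Q′ = p²∤Δ (ℤDiv.∣⇒∣ᵤ (Equivalence.from p²∣Δ⇔P∣Q′ P∣Q′))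

    mρ-reduce-ramified : + (p ℕ.* p) ∣ Δ → ∀ {ϱ′} → InR (N ℕ.* p) Δ ϱ′
                       → mρ (N ℕ.* p) Δ ϱ′ ≡ P * mρ N Δ (reduce N ϱ′)
    mρ-reduce-ramified p²∣Δ ϱ′∈R = trans mρ-lift
      (trans (gcd₃-factor-prime p-prime p∤n P∣ϱ′ (Equivalence.to p²∣Δ⇔P∣Q′ (ℤDiv.∣ᵤ⇒∣ p²∣Δ)))
             (cong (P *_) (sym mρ-reduce)))
      where
      open Lift ϱ′∈R

open import Data.Nat using (_≥_; _*_)

lemma3p3 : (N p : ℕ) (Δ : ℤ)
    → N ≥ 1 → ¬ (2 ℕDiv.∣ N)
    → Prime p → ¬ (2 ℕDiv.∣ p) → ¬ (p ℕDiv.∣ N)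
    → IsDiscriminant Δ → + p ∣ Δ
    → ∃[ ϱ ] InR N Δ ϱ
    → (∀ ϱ' → InR (N * p) Δ ϱ' → InR N Δ (reduce N ϱ'))
      × (∀ a b → InR (N * p) Δ a → InR (N * p) Δ b → reduce N a ≡ reduce N b → a ≡ b)
      × (∀ ϱ → InR N Δ ϱ → ∃[ ϱ' ] (InR (N * p) Δ ϱ' × reduce N ϱ' ≡ ϱ))
      × (¬ (+ (p * p) ∣ Δ) → ∀ ϱ' → InR (N * p) Δ ϱ' → mρ (N * p) Δ ϱ' ≡ mρ N Δ (reduce N ϱ'))
      × (+ (p * p) ∣ Δ → ∀ ϱ' → InR (N * p) Δ ϱ' → mρ (N * p) Δ ϱ' ≡ + p ℤ.* mρ N Δ (reduce N ϱ'))
lemma3p3 N p Δ N≥1 _ p-prime 2∤p p∤N _ p∣Δ _ =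
    (λ _ → Lift.reduce∈R)
  , (λ _ _ → reduce-injective)
  , (λ _ → reduce-surjective)
  , (λ p²∤Δ _ → mρ-reduce-unramified p²∤Δ)
  , (λ p²∣Δ _ → mρ-reduce-ramified p²∣Δ)
  where
  instance
    _ : NonZero N
    _ = ℕ.>-nonZero N≥1
  open Lifting N p Δ p-prime (odd-prime∤4* p-prime 2∤p p∤N) p∣Δ
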